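{- Let $\lambda=[\lambda_1,\ldots,\lambda_k]$ be a partition, $n$ a positive integer, and $v$ a strictly increasing vector of length $k$ with entries in $\{1,\ldots,n\}$. The vertices of $P(v,\lambda,n)$ are exactly the matrices in $M(v,\lambda,n)$.
   Context: A partition is a weakly decreasing sequence of positive integers $\lambda=[\lambda_1,\ldots,\lambda_k]$; $a_i$ is the number of parts equal to $i$. A sign matrix is a matrix with entries in $\{ -1,0,1\}$ whose column partial sums from the top lie in $\{0,1\}$ and whose row partial sums from the left are nonnegative. $M(\lambda,n)$ is the set of $\lambda_1\times n$ sign matrices whose $i$-th row sums to $a_{\lambda_1-i+1}$. $M(v,\lambda,n)$ is the set of $M\in M(\lambda,n)$ whose $j$-th column sums to $1$ if $j$ is an entry of $v$ and to $0$ otherwise. $P(v,\lambda,n)$ is the convex hull of $M(v,\lambda,n)$ in $\mathbb{R}^{\lambda_1 n}$.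
   Formalization: The polytope $P(v,\lambda,n)$ is taken as the convex hull of $M(v,\lambda,n)$ in ℚ^(λ₁n) rather than $\mathbb{R}^{\lambda_1 n}$, with rational coefficients, and its vertices range over points with rational coordinates. -}

module Defs where

open import Data.Nat as ℕ using (ℕ; zero; suc; _≤ᵇ_)
open import Data.Fin using (Fin; toℕ)
open import Data.List using (List; []; _∷_; length)
open import Data.Vec using (Vec; lookup)
open import Data.Integer as ℤ using (ℤ)
open import Data.Rational as ℚ using (ℚ; 0ℚ; 1ℚ)
open import Data.Product using (Σ; _×_; _,_; ∃)
open import Data.Sum using (_⊎_)
open import Data.Bool using (if_then_else_)
open import Relation.Binary.PropositionalEquality using (_≡_)
open import Relation.Nullary using (yes; no)
open import Data.Empty using (⊥)
open import Data.Unit using (⊤)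
import Data.Fin as Fin

data IsPartition : List ℕ → Set where
  []ᵖ  : IsPartition []
  [_]ᵖ : ∀ {x} → 1 ℕ.≤ x → IsPartition (x ∷ [])
  consᵖ : ∀ {x y l} → y ℕ.≤ x → IsPartition (y ∷ l) → IsPartition (x ∷ y ∷ l)

largest : List ℕ → ℕ
largest []      = 0
largest (x ∷ _) = x

-- a_i = number of parts equal to i
mult : List ℕ → ℕ → ℕ
mult []      i = 0
mult (x ∷ l) i with x ℕ.≟ i
... | yes _ = suc (mult l i)
... | no  _ = mult l i

sumℤ : (m : ℕ) → (Fin m → ℤ) → ℤ
sumℤ zero    f = ℤ.0ℤ
sumℤ (suc m) f = f Fin.zero ℤ.+ sumℤ m (λ i → f (Fin.suc i))

psum : {m : ℕ} → (Fin m → ℤ) → Fin m → ℤ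
psum {m} f p = sumℤ m (λ i → if toℕ i ≤ᵇ toℕ p then f i else ℤ.0ℤ)

Mat : ℕ → ℕ → Set
Mat m n = Fin m → Fin n → ℤ

IsSignMatrix : {m n : ℕ} → Mat m n → Set
IsSignMatrix {m} {n} M =
  (∀ i j → M i j ≡ ℤ.-1ℤ ⊎ M i j ≡ ℤ.0ℤ ⊎ M i j ≡ ℤ.1ℤ)
  × (∀ j (p : Fin m) → psum (λ i → M i j) p ≡ ℤ.0ℤ ⊎ psum (λ i → M i j) p ≡ ℤ.1ℤ)
  × (∀ i (p : Fin n) → ℤ.0ℤ ℤ.≤ psum (λ j → M i j) p)

-- M(λ,n): λ₁ × n sign matrices whose i-th row (1-indexed) sums to a_{λ₁-i+1}.
-- With 0-indexed row r this is a_{λ₁ - r}.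
InM : (lam : List ℕ) (n : ℕ) → Mat (largest lam) n → Set
InM lam n M =
  IsSignMatrix M
  × (∀ r → sumℤ n (λ j → M r j) ≡ ℤ.+ (mult lam (largest lam ℕ.∸ toℕ r)))

EntryOf : {k : ℕ} → ℕ → Vec ℕ k → Set
EntryOf {k} j v = ∃ λ (t : Fin k) → lookup v t ≡ j

-- M(v,λ,n): column j (1-indexed, i.e. 0-indexed c with j = c+1) sums to 1
-- if j is an entry of v and to 0 otherwise.
InMv : {k : ℕ} (v : Vec ℕ k) (lam : List ℕ) (n : ℕ) → Mat (largest lam) n → Set
InMv v lam n M =
  InM lam n M
  × (∀ c → (EntryOf (suc (toℕ c)) v → sumℤ (largest lam) (λ i → M i c) ≡ ℤ.1ℤ)
         × ((EntryOf (suc (toℕ c)) v → ⊥) → sumℤ (largest lam) (λ i → M i c) ≡ ℤ.0ℤ))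

StrictlyIncreasing : {k : ℕ} → Vec ℕ k → Set
StrictlyIncreasing {k} v = ∀ (s t : Fin k) → toℕ s ℕ.< toℕ t → lookup v s ℕ.< lookup v t

EntriesIn1toN : {k : ℕ} → ℕ → Vec ℕ k → Set
EntriesIn1toN {k} n v = ∀ (t : Fin k) → 1 ℕ.≤ lookup v t × lookup v t ℕ.≤ n

QMat : ℕ → ℕ → Set
QMat m n = Fin m → Fin n → ℚ

embed : {m n : ℕ} → Mat m n → QMat m n
embed M i j = M i j ℚ./ 1

wsum : {m n : ℕ} → List (ℚ × Mat m n) → QMat m n
wsum []              i j = 0ℚ
wsum ((q , A) ∷ l) i j = q ℚ.* (A i j ℚ./ 1) ℚ.+ wsum l i j

coeffSum : {m n : ℕ} → List (ℚ × Mat m n) → ℚ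
coeffSum []            = 0ℚ
coeffSum ((q , _) ∷ l) = q ℚ.+ coeffSum l

AllOK : {m n : ℕ} → (Mat m n → Set) → List (ℚ × Mat m n) → Set
AllOK S []            = ⊤
AllOK S ((q , A) ∷ l) = (0ℚ ℚ.≤ q) × S A × AllOK S l

InConvexHull : {m n : ℕ} → (Mat m n → Set) → QMat m n → Set
InConvexHull S x = Σ _ λ l → AllOK S l × coeffSum l ≡ 1ℚ × (∀ i j → x i j ≡ wsum l i j)

IsVertex : {m n : ℕ} → (Mat m n → Set) → QMat m n → Set
IsVertex S x =
  InConvexHull S x
  × (∀ y z (t : ℚ) → InConvexHull S y → InConvexHull S z → 0ℚ ℚ.< t → t ℚ.< 1ℚ
      → (∀ i j → x i j ≡ t ℚ.* y i j ℚ.+ (1ℚ ℚ.- t) ℚ.* z i j)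
      → (∀ i j → y i j ≡ x i j) × (∀ i j → z i j ≡ x i j))

module Submission where

-- Only one property of M(v,λ,n) matters: it is a set S of integer matrices
-- whose column partial sums all lie in {0,1}.  For any such S the vertices of
-- conv(S) are exactly the points of S, by two independent arguments.
--
-- * Every vertex of conv(S) lies in S, for an arbitrary set S: write the vertex
--   x as a convex combination Σ qₖ Aₖ; drop terms of weight 0; if the first term
--   has weight 1 then x = A₁, and if its weight q lies in (0,1) then
--   x = q·A₁ + (1-q)·z with z the renormalised remaining combination, so
--   extremality forces A₁ = x.
-- * Every point M of S is a vertex: the map x ↦ (column partial sums of x) is
--   linear, it sends conv(S) into [0,1]^(m×n) and M to a 0/1-point.  A 0/1-point
--   is extreme in [0,1], so if M = t·y + (1-t)·z with y, z ∈ conv(S) the partial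
--   sums of y and z agree with those of M, hence so do the entries.

open import Defs
open import Data.Nat using (ℕ; _≤_)
open import Data.List using (List; length)
open import Data.Vec using (Vec)
open import Data.Product using (Σ; _×_)
open import Relation.Binary.PropositionalEquality using (_≡_)
open import Function.Bundles using (_⇔_)

open import Data.Nat using (zero; suc; _≤ᵇ_)
open import Data.Fin as Fin using (Fin; toℕ)
open import Data.List using ([]; _∷_)
open import Data.Bool using (true; false; if_then_else_)
open import Data.Integer as ℤ using (ℤ)
import Data.Integer.Properties as ℤP
open import Data.Rational as Q using (ℚ; 0ℚ; 1ℚ; _/_; _+_; _*_; _-_; -_; 1/_)
  renaming (_≤_ to _≤q_; _<_ to _<q_)
import Data.Rational.Properties as QP
import Data.Rational.Unnormalised as U
import Data.Rational.Unnormalised.Properties as UP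
open import Data.Rational.Solver using (module +-*-Solver)
open +-*-Solver
open import Data.Product using (_,_; proj₁; proj₂)
open import Data.Sum using (_⊎_; inj₁; inj₂)
open import Data.Empty using (⊥-elim)
open import Data.Unit using (tt)
open import Relation.Binary.PropositionalEquality using (refl; sym; trans; cong; cong₂; subst; module ≡-Reasoning)
open import Relation.Binary.Definitions using (tri<; tri≈; tri>)
open import Function.Bundles using (mk⇔)

sumQ : (m : ℕ) → (Fin m → ℚ) → ℚ
sumQ zero    f = 0ℚ
sumQ (suc m) f = f Fin.zero + sumQ m (λ i → f (Fin.suc i))

psumQ : {m : ℕ} → (Fin m → ℚ) → Fin m → ℚ
psumQ {m} f p = sumQ m (λ i → if toℕ i ≤ᵇ toℕ p then f i else 0ℚ)

sumQ-cong : ∀ m {f g : Fin m → ℚ} → (∀ i → f i ≡ g i) → sumQ m f ≡ sumQ m g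
sumQ-cong zero    e = refl
sumQ-cong (suc m) e = cong₂ _+_ (e Fin.zero) (sumQ-cong m (λ i → e (Fin.suc i)))

psumQ-cong : ∀ {m} {f g : Fin m → ℚ} → (∀ i → f i ≡ g i) → ∀ p → psumQ f p ≡ psumQ g p
psumQ-cong {m} e p = sumQ-cong m (λ i → cong (if toℕ i ≤ᵇ toℕ p then_else 0ℚ) (e i))

sumQ-zero : ∀ m → sumQ m (λ _ → 0ℚ) ≡ 0ℚ
sumQ-zero zero    = refl
sumQ-zero (suc m) = cong (0ℚ +_) (sumQ-zero m)

sumQ-linear : ∀ m (a : ℚ) (f g : Fin m → ℚ) →
  sumQ m (λ i → a * f i + g i) ≡ a * sumQ m f + sumQ m g
sumQ-linear zero a f g = solve 1 (λ a → con 0ℚ := a :* con 0ℚ :+ con 0ℚ) refl a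
sumQ-linear (suc m) a f g =
  trans (cong (a * f Fin.zero + g Fin.zero +_)
          (sumQ-linear m a (λ i → f (Fin.suc i)) (λ i → g (Fin.suc i))))
        (solve 5 (λ a x y u w → (a :* x :+ y) :+ (a :* u :+ w) := a :* (x :+ u) :+ (y :+ w)) refl
          a (f Fin.zero) (g Fin.zero) (sumQ m (λ i → f (Fin.suc i))) (sumQ m (λ i → g (Fin.suc i))))

sumQ-scale : ∀ m (a : ℚ) (f : Fin m → ℚ) → sumQ m (λ i → a * f i) ≡ a * sumQ m f
sumQ-scale m a f =
  trans (sumQ-cong m (λ i → sym (QP.+-identityʳ (a * f i))))
        (trans (sumQ-linear m a f (λ _ → 0ℚ))
               (trans (cong (a * sumQ m f +_) (sumQ-zero m)) (QP.+-identityʳ _)))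

mask-linear : ∀ b (a x y : ℚ) →
  (if b then a * x + y else 0ℚ) ≡ a * (if b then x else 0ℚ) + (if b then y else 0ℚ)
mask-linear true  a x y = refl
mask-linear false a x y = solve 1 (λ a → con 0ℚ := a :* con 0ℚ :+ con 0ℚ) refl a

mask-scale : ∀ b (a x : ℚ) → (if b then a * x else 0ℚ) ≡ a * (if b then x else 0ℚ)
mask-scale true  a x = refl
mask-scale false a x = sym (QP.*-zeroʳ a)

psumQ-linear : ∀ {m} (a : ℚ) (f g : Fin m → ℚ) p →
  psumQ (λ i → a * f i + g i) p ≡ a * psumQ f p + psumQ g p
psumQ-linear {m} a f g p =
  trans (sumQ-cong m (λ i → mask-linear (toℕ i ≤ᵇ toℕ p) a (f i) (g i))) (sumQ-linear m a _ _)

psumQ-scale : ∀ {m} (a : ℚ) (f : Fin m → ℚ) p → psumQ (λ i → a * f i) p ≡ a * psumQ f p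
psumQ-scale {m} a f p =
  trans (sumQ-cong m (λ i → mask-scale (toℕ i ≤ᵇ toℕ p) a (f i))) (sumQ-scale m a _)

psumQ-zero : ∀ {m} p → psumQ {m} (λ _ → 0ℚ) p ≡ 0ℚ
psumQ-zero {m} p = trans (sumQ-cong m (λ i → masked-zero (toℕ i ≤ᵇ toℕ p))) (sumQ-zero m)
  where
  masked-zero : ∀ b → (if b then 0ℚ else 0ℚ) ≡ 0ℚ
  masked-zero true  = refl
  masked-zero false = refl

-- The partial sums of a sequence determine the sequence: the first term is the
-- first partial sum, and the later partial sums, minus the first term, are the
-- partial sums of the tail.

psumQ-first : ∀ {m} (f : Fin (suc m) → ℚ) → psumQ f Fin.zero ≡ f Fin.zero
psumQ-first {m} f = trans (cong (f Fin.zero +_) (sumQ-zero m)) (QP.+-identityʳ _)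

psumQ-suc : ∀ {m} (f : Fin (suc m) → ℚ) p →
  psumQ f (Fin.suc p) ≡ f Fin.zero + psumQ (λ i → f (Fin.suc i)) p
psumQ-suc {m} f p = cong (f Fin.zero +_) (sumQ-cong m (λ i → mask-suc (toℕ i) (toℕ p) (f (Fin.suc i))))
  where
  mask-suc : ∀ a b (x : ℚ) → (if suc a ≤ᵇ suc b then x else 0ℚ) ≡ (if a ≤ᵇ b then x else 0ℚ)
  mask-suc zero    b x = refl
  mask-suc (suc a) b x = refl

+-cancelˡ : ∀ a b c → a + b ≡ a + c → b ≡ c
+-cancelˡ a b c e = trans (solve 2 (λ a b → b := (a :+ b) :- a) refl a b)
                   (trans (cong (_- a) e) (solve 2 (λ a c → (a :+ c) :- a := c) refl a c))

psumQ-injective : ∀ m (d e : Fin m → ℚ) → (∀ p → psumQ d p ≡ psumQ e p) → ∀ i → d i ≡ e i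
psumQ-injective (suc m) d e same Fin.zero =
  trans (sym (psumQ-first d)) (trans (same Fin.zero) (psumQ-first e))
psumQ-injective (suc m) d e same (Fin.suc i) =
  psumQ-injective m (λ i → d (Fin.suc i)) (λ i → e (Fin.suc i)) same-tail i
  where
  same-head : d Fin.zero ≡ e Fin.zero
  same-head = psumQ-injective (suc m) d e same Fin.zero
  same-tail : ∀ p → psumQ (λ i → d (Fin.suc i)) p ≡ psumQ (λ i → e (Fin.suc i)) p
  same-tail p = +-cancelˡ (d Fin.zero) _ _
    (trans (sym (psumQ-suc d p))
      (trans (same (Fin.suc p)) (trans (psumQ-suc e p) (cong (_+ _) (sym same-head)))))

/1-homo-+ : ∀ a b → (a ℤ.+ b) / 1 ≡ (a / 1) + (b / 1)
/1-homo-+ a b = QP.toℚᵘ-injective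
  (UP.≃-trans (QP.toℚᵘ-fromℚᵘ (U.mkℚᵘ (a ℤ.+ b) 0))
    (UP.≃-trans unnormalised
      (UP.≃-sym (UP.≃-trans (QP.toℚᵘ-homo-+ (a / 1) (b / 1))
        (UP.+-cong (QP.toℚᵘ-fromℚᵘ (U.mkℚᵘ a 0)) (QP.toℚᵘ-fromℚᵘ (U.mkℚᵘ b 0)))))))
  where
  unnormalised : U.mkℚᵘ (a ℤ.+ b) 0 U.≃ (U.mkℚᵘ a 0 U.+ U.mkℚᵘ b 0)
  unnormalised = U.*≡* (cong (ℤ._* ℤ.1ℤ) (sym (cong₂ ℤ._+_ (ℤP.*-identityʳ a) (ℤP.*-identityʳ b))))

sum-embed : ∀ m (f : Fin m → ℤ) → sumℤ m f / 1 ≡ sumQ m (λ i → f i / 1)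
sum-embed zero    f = refl
sum-embed (suc m) f =
  trans (/1-homo-+ (f Fin.zero) _) (cong ((f Fin.zero / 1) +_) (sum-embed m (λ i → f (Fin.suc i))))

psum-embed : ∀ {m} (f : Fin m → ℤ) p → psum f p / 1 ≡ psumQ (λ i → f i / 1) p
psum-embed {m} f p = trans (sum-embed m _) (sumQ-cong m (λ i → mask-embed (toℕ i ≤ᵇ toℕ p) (f i)))
  where
  mask-embed : ∀ b (x : ℤ) → ((if b then x else ℤ.0ℤ) / 1) ≡ (if b then x / 1 else 0ℚ)
  mask-embed true  x = refl
  mask-embed false x = refl

complement : ∀ q c → q + c ≡ 1ℚ → c ≡ 1ℚ - q
complement q c total = trans (solve 2 (λ c q → c := (q :+ c) :- q) refl c q) (cong (_- q) total)

0≤1 : 0ℚ ≤q 1ℚ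
0≤1 = QP.<⇒≤ (QP.positive⁻¹ 1ℚ)

0≤-difference : ∀ {p q} → p ≤q q → 0ℚ ≤q q - p
0≤-difference {p} {q} p≤q = subst (_≤q q - p) (QP.+-inverseʳ p) (QP.+-monoˡ-≤ (- p) p≤q)

0<-difference : ∀ {p q} → p <q q → 0ℚ <q q - p
0<-difference {p} {q} p<q = subst (_<q q - p) (QP.+-inverseʳ p) (QP.+-monoˡ-< (- p) p<q)

0≤-* : ∀ {a b} → 0ℚ ≤q a → 0ℚ ≤q b → 0ℚ ≤q a * b
0≤-* {a} {b} 0≤a 0≤b =
  subst (_≤q a * b) (QP.*-zeroʳ a) (QP.*-monoˡ-≤-nonNeg a {{Q.nonNegative 0≤a}} 0≤b)

≤-+-nonneg : ∀ a {b} → 0ℚ ≤q b → a ≤q a + b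
≤-+-nonneg a {b} 0≤b = subst (_≤q a + b) (QP.+-identityʳ a) (QP.+-monoʳ-≤ a 0≤b)

nonneg-sum-zero : ∀ a b → 0ℚ ≤q a → 0ℚ ≤q b → a + b ≡ 0ℚ → a ≡ 0ℚ
nonneg-sum-zero a b 0≤a 0≤b e = QP.≤-antisym (subst (a ≤q_) e (≤-+-nonneg a 0≤b)) 0≤a

weighted-sum-zero : ∀ s b w → 0ℚ <q s → 0ℚ ≤q b → 0ℚ ≤q w → s * b + w ≡ 0ℚ → b ≡ 0ℚ
weighted-sum-zero s b w 0<s 0≤b 0≤w e = begin
  b                ≡⟨ sym (QP.*-identityˡ b) ⟩
  1ℚ * b           ≡⟨ cong (_* b) (sym (QP.*-inverseˡ s)) ⟩
  (1/ s * s) * b   ≡⟨ QP.*-assoc (1/ s) s b ⟩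
  1/ s * (s * b)   ≡⟨ cong (1/ s *_) sb≡0 ⟩
  1/ s * 0ℚ        ≡⟨ QP.*-zeroʳ (1/ s) ⟩
  0ℚ               ∎
  where
  open ≡-Reasoning
  instance
    s≢0 : Q.NonZero s
    s≢0 = QP.pos⇒nonZero s {{Q.positive 0<s}}
  sb≡0 : s * b ≡ 0ℚ
  sb≡0 = nonneg-sum-zero (s * b) w (0≤-* (QP.<⇒≤ 0<s) 0≤b) 0≤w e

-- 0 and 1 are extreme points of [0,1]: if a ∈ {0,1}, b, c ∈ [0,1], 0 < t < 1 and
-- a = t·b + (1-t)·c, then b = c = a.  The case a = 1 reduces to a = 0 via u ↦ 1 - u.

IsZeroOne : ℚ → Set
IsZeroOne a = a ≡ 0ℚ ⊎ a ≡ 1ℚ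

zero-extreme : ∀ b c t → 0ℚ ≤q b → 0ℚ ≤q c → 0ℚ <q t → t <q 1ℚ →
  0ℚ ≡ t * b + (1ℚ - t) * c → b ≡ 0ℚ × c ≡ 0ℚ
zero-extreme b c t 0≤b 0≤c 0<t t<1 e =
  weighted-sum-zero t b ((1ℚ - t) * c) 0<t 0≤b (0≤-* (QP.<⇒≤ 0<1-t) 0≤c) (sym e) ,
  weighted-sum-zero (1ℚ - t) c (t * b) 0<1-t 0≤c (0≤-* (QP.<⇒≤ 0<t) 0≤b)
    (trans (QP.+-comm ((1ℚ - t) * c) (t * b)) (sym e))
  where
  0<1-t : 0ℚ <q 1ℚ - t
  0<1-t = 0<-difference t<1

zero-one-extreme : ∀ a b c t → IsZeroOne a → 0ℚ ≤q b → b ≤q 1ℚ → 0ℚ ≤q c → c ≤q 1ℚ →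
  0ℚ <q t → t <q 1ℚ → a ≡ t * b + (1ℚ - t) * c → b ≡ a × c ≡ a
zero-one-extreme a b c t (inj₁ refl) 0≤b _ 0≤c _ 0<t t<1 e = zero-extreme b c t 0≤b 0≤c 0<t t<1 e
zero-one-extreme a b c t (inj₂ refl) _ b≤1 _ c≤1 0<t t<1 e =
  complement-zero b (proj₁ complements) , complement-zero c (proj₂ complements)
  where
  reflected : 0ℚ ≡ t * (1ℚ - b) + (1ℚ - t) * (1ℚ - c)
  reflected = trans (trans (sym (QP.+-inverseʳ 1ℚ)) (cong (λ u → 1ℚ - u) e))
    (solve 3 (λ b c t → con 1ℚ :- (t :* b :+ (con 1ℚ :- t) :* c)
                      := t :* (con 1ℚ :- b) :+ (con 1ℚ :- t) :* (con 1ℚ :- c)) refl b c t)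
  complements : 1ℚ - b ≡ 0ℚ × 1ℚ - c ≡ 0ℚ
  complements = zero-extreme (1ℚ - b) (1ℚ - c) t (0≤-difference b≤1) (0≤-difference c≤1) 0<t t<1 reflected
  complement-zero : ∀ u → 1ℚ - u ≡ 0ℚ → u ≡ 1ℚ
  complement-zero u h = trans (solve 1 (λ u → u := con 1ℚ :- (con 1ℚ :- u)) refl u) (cong (λ u → 1ℚ - u) h)

module ConvexHull {m n : ℕ} (S : Mat m n → Set) where

  IsExtreme : QMat m n → Set
  IsExtreme x = ∀ y z (t : ℚ) → InConvexHull S y → InConvexHull S z → 0ℚ <q t → t <q 1ℚ
    → (∀ i j → x i j ≡ t * y i j + (1ℚ - t) * z i j)
    → (∀ i j → y i j ≡ x i j) × (∀ i j → z i j ≡ x i j)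

  point-in-hull : ∀ {x} A → S A → (∀ i j → x i j ≡ embed A i j) → InConvexHull S x
  point-in-hull A SA x≡A = ((1ℚ , A) ∷ []) , (0≤1 , SA , tt) , QP.+-identityʳ 1ℚ ,
    λ i j → trans (x≡A i j) (sym (trans (QP.+-identityʳ _) (QP.*-identityˡ _)))

  weight-nonneg : ∀ l → AllOK S l → 0ℚ ≤q coeffSum l
  weight-nonneg []            _              = QP.≤-refl
  weight-nonneg ((q , A) ∷ l) (0≤q , _ , ok) = QP.+-mono-≤ 0≤q (weight-nonneg l ok)

  null-combination : ∀ l → AllOK S l → coeffSum l ≡ 0ℚ → ∀ i j → wsum l i j ≡ 0ℚ
  null-combination []            _              _     i j = refl
  null-combination ((q , A) ∷ l) (0≤q , _ , ok) total i j =
    trans (cong₂ _+_ (trans (cong (_* (A i j / 1)) q≡0) (QP.*-zeroˡ (A i j / 1)))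
                     (null-combination l ok rest≡0 i j))
          (QP.+-identityʳ 0ℚ)
    where
    q≡0 : q ≡ 0ℚ
    q≡0 = nonneg-sum-zero q (coeffSum l) 0≤q (weight-nonneg l ok) total
    rest≡0 : coeffSum l ≡ 0ℚ
    rest≡0 = nonneg-sum-zero (coeffSum l) q (weight-nonneg l ok) 0≤q
               (trans (QP.+-comm (coeffSum l) q) total)

  scale : ℚ → List (ℚ × Mat m n) → List (ℚ × Mat m n)
  scale w []            = []
  scale w ((q , A) ∷ l) = (w * q , A) ∷ scale w l

  wsum-scale : ∀ w l i j → wsum (scale w l) i j ≡ w * wsum l i j
  wsum-scale w []            i j = sym (QP.*-zeroʳ w)
  wsum-scale w ((q , A) ∷ l) i j =
    trans (cong ((w * q) * (A i j / 1) +_) (wsum-scale w l i j))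
      (solve 4 (λ w q a u → (w :* q) :* a :+ w :* u := w :* (q :* a :+ u)) refl
        w q (A i j / 1) (wsum l i j))

  coeffSum-scale : ∀ w l → coeffSum (scale w l) ≡ w * coeffSum l
  coeffSum-scale w []            = sym (QP.*-zeroʳ w)
  coeffSum-scale w ((q , A) ∷ l) =
    trans (cong ((w * q) +_) (coeffSum-scale w l))
      (solve 3 (λ w q u → w :* q :+ w :* u := w :* (q :+ u)) refl w q (coeffSum l))

  AllOK-scale : ∀ w → 0ℚ ≤q w → ∀ l → AllOK S l → AllOK S (scale w l)
  AllOK-scale w 0≤w []            _               = tt
  AllOK-scale w 0≤w ((q , A) ∷ l) (0≤q , SA , ok) = 0≤-* 0≤w 0≤q , SA , AllOK-scale w 0≤w l ok

  renormalise : ∀ s → 0ℚ <q s → ∀ l → AllOK S l → coeffSum l ≡ s →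
    Σ (QMat m n) λ z → InConvexHull S z × (∀ i j → s * z i j ≡ wsum l i j)
  renormalise s 0<s l ok total =
    (λ i j → wsum (scale (1/ s) l) i j) ,
    (scale (1/ s) l , AllOK-scale (1/ s) 0≤1/s l ok ,
      trans (coeffSum-scale (1/ s) l) (trans (cong (1/ s *_) total) (QP.*-inverseˡ s)) ,
      λ i j → refl) ,
    λ i j → trans (cong (s *_) (wsum-scale (1/ s) l i j))
              (trans (sym (QP.*-assoc s (1/ s) (wsum l i j)))
                (trans (cong (_* wsum l i j) (QP.*-inverseʳ s)) (QP.*-identityˡ _)))
    where
    instance
      s≢0 : Q.NonZero s
      s≢0 = QP.pos⇒nonZero s {{Q.positive 0<s}}
    0≤1/s : 0ℚ ≤q 1/ s
    0≤1/s = QP.<⇒≤ (QP.positive⁻¹ (1/ s) {{QP.1/pos⇒pos s {{Q.positive 0<s}}}})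

  extreme-in-S : ∀ x → IsExtreme x → ∀ l → AllOK S l → coeffSum l ≡ 1ℚ →
    (∀ i j → x i j ≡ wsum l i j) → Σ _ (λ M → S M × (∀ i j → x i j ≡ embed M i j))
  extreme-in-S x extreme [] _ total _ = ⊥-elim (QP.1≢0 (sym total))
  extreme-in-S x extreme ((q , A) ∷ l) (0≤q , SA , ok) total x≡ with QP.<-cmp q 0ℚ | QP.<-cmp q 1ℚ
  ... | tri< q<0 _ _ | _ = ⊥-elim (QP.<-irrefl refl (QP.<-≤-trans q<0 0≤q))
  ... | tri≈ _ q≡0 _ | _ =
    extreme-in-S x extreme l ok
      (trans (sym (QP.+-identityˡ _)) (trans (cong (_+ coeffSum l) (sym q≡0)) total))
      (λ i j → trans (x≡ i j) (trans (cong (λ u → u * (A i j / 1) + wsum l i j) q≡0)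
        (trans (cong (_+ wsum l i j) (QP.*-zeroˡ (A i j / 1))) (QP.+-identityˡ (wsum l i j)))))
  ... | tri> _ _ _ | tri> _ _ q>1 =
    ⊥-elim (QP.<-irrefl refl (QP.<-≤-trans q>1 q≤1))
    where
    q≤1 : q ≤q 1ℚ
    q≤1 = subst (q ≤q_) total (≤-+-nonneg q (weight-nonneg l ok))
  ... | tri> _ _ _ | tri≈ _ q≡1 _ = A , SA , λ i j →
    trans (x≡ i j) (trans (cong₂ _+_ (trans (cong (_* (A i j / 1)) q≡1) (QP.*-identityˡ (A i j / 1)))
                                     (null-combination l ok rest≡0 i j))
                          (QP.+-identityʳ _))
    where
    rest≡0 : coeffSum l ≡ 0ℚ
    rest≡0 = trans (complement q (coeffSum l) total) (trans (cong (λ u → 1ℚ - u) q≡1) (QP.+-inverseʳ 1ℚ))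
  ... | tri> _ _ 0<q | tri< q<1 _ _ =
    A , SA , λ i j → sym (proj₁ (extreme (embed A) z q A∈hull z∈hull 0<q q<1 x≡qA+rest) i j)
    where
    renormalised : Σ (QMat m n) λ z → InConvexHull S z × (∀ i j → (1ℚ - q) * z i j ≡ wsum l i j)
    renormalised = renormalise (1ℚ - q) (0<-difference q<1) l ok (complement q (coeffSum l) total)
    z : QMat m n
    z = proj₁ renormalised
    z∈hull : InConvexHull S z
    z∈hull = proj₁ (proj₂ renormalised)
    A∈hull : InConvexHull S (embed A)
    A∈hull = point-in-hull A SA (λ _ _ → refl)
    x≡qA+rest : ∀ i j → x i j ≡ q * embed A i j + (1ℚ - q) * z i j
    x≡qA+rest i j = trans (x≡ i j) (cong (q * (A i j / 1) +_) (sym (proj₂ (proj₂ renormalised) i j)))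

add-zero-one-term : ∀ q a P C → 0ℚ ≤q q → IsZeroOne a → 0ℚ ≤q P → P ≤q C →
  0ℚ ≤q q * a + P × q * a + P ≤q q + C
add-zero-one-term q a P C 0≤q (inj₁ refl) 0≤P P≤C =
  subst (0ℚ ≤q_) (sym q·0+P≡P) 0≤P ,
  subst (_≤q q + C) (sym q·0+P≡P) (QP.≤-trans P≤C C≤q+C)
  where
  C≤q+C : C ≤q q + C
  C≤q+C = subst (_≤q q + C) (QP.+-identityˡ C) (QP.+-monoˡ-≤ C 0≤q)
  q·0+P≡P : q * 0ℚ + P ≡ P
  q·0+P≡P = trans (cong (_+ P) (QP.*-zeroʳ q)) (QP.+-identityˡ P)
add-zero-one-term q a P C 0≤q (inj₂ refl) 0≤P P≤C =
  subst (0ℚ ≤q_) (sym q·1+P≡q+P) (QP.+-mono-≤ 0≤q 0≤P) ,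
  subst (_≤q q + C) (sym q·1+P≡q+P) (QP.+-monoʳ-≤ q P≤C)
  where
  q·1+P≡q+P : q * 1ℚ + P ≡ q + P
  q·1+P≡q+P = cong (_+ P) (QP.*-identityʳ q)

ZeroOneColumns : {m n : ℕ} → (Mat m n → Set) → Set
ZeroOneColumns {m} S = ∀ A → S A → ∀ j (p : Fin m) →
  psum (λ i → A i j) p ≡ ℤ.0ℤ ⊎ psum (λ i → A i j) p ≡ ℤ.1ℤ

module ZeroOneColumnHull {m n : ℕ} (S : Mat m n → Set) (zero-one : ZeroOneColumns S) where
  open ConvexHull S

  columnPsum : QMat m n → Fin n → Fin m → ℚ
  columnPsum x j p = psumQ (λ i → x i j) p

  point-zero-one : ∀ A → S A → ∀ j p → IsZeroOne (columnPsum (embed A) j p)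
  point-zero-one A SA j p with zero-one A SA j p
  ... | inj₁ e = inj₁ (trans (sym (psum-embed (λ i → A i j) p)) (cong (_/ 1) e))
  ... | inj₂ e = inj₂ (trans (sym (psum-embed (λ i → A i j) p)) (cong (_/ 1) e))

  combination-bounds : ∀ l → AllOK S l → ∀ j p →
    0ℚ ≤q columnPsum (wsum l) j p × columnPsum (wsum l) j p ≤q coeffSum l
  combination-bounds [] _ j p =
    subst (0ℚ ≤q_) (sym (psumQ-zero p)) QP.≤-refl , subst (_≤q 0ℚ) (sym (psumQ-zero p)) QP.≤-refl
  combination-bounds ((q , A) ∷ l) (0≤q , SA , ok) j p =
    subst (λ P → 0ℚ ≤q P × P ≤q q + coeffSum l) (sym (psumQ-linear q (λ i → embed A i j) (λ i → wsum l i j) p))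
      (add-zero-one-term q _ _ _ 0≤q (point-zero-one A SA j p)
        (proj₁ (combination-bounds l ok j p)) (proj₂ (combination-bounds l ok j p)))

  hull-bounds : ∀ y → InConvexHull S y → ∀ j p → 0ℚ ≤q columnPsum y j p × columnPsum y j p ≤q 1ℚ
  hull-bounds y (l , ok , total , y≡) j p =
    subst (λ P → 0ℚ ≤q P × P ≤q 1ℚ) (sym (psumQ-cong (λ i → y≡ i j) p))
      (subst (λ C → 0ℚ ≤q columnPsum (wsum l) j p × columnPsum (wsum l) j p ≤q C) total
        (combination-bounds l ok j p))

  point-extreme : ∀ x M → S M → (∀ i j → x i j ≡ embed M i j) → IsExtreme x
  point-extreme x M SM x≡M y z t y∈hull z∈hull 0<t t<1 x≡ty+z =
    (λ i j → psumQ-injective m _ _ (λ p → proj₁ (same-psums j p)) i) ,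
    (λ i j → psumQ-injective m _ _ (λ p → proj₂ (same-psums j p)) i)
    where
    same-psums : ∀ j p → columnPsum y j p ≡ columnPsum x j p × columnPsum z j p ≡ columnPsum x j p
    same-psums j p =
      zero-one-extreme (columnPsum x j p) (columnPsum y j p) (columnPsum z j p) t
        (subst IsZeroOne (sym (psumQ-cong (λ i → x≡M i j) p)) (point-zero-one M SM j p))
        (proj₁ (hull-bounds y y∈hull j p)) (proj₂ (hull-bounds y y∈hull j p))
        (proj₁ (hull-bounds z z∈hull j p)) (proj₂ (hull-bounds z z∈hull j p)) 0<t t<1
        (trans (psumQ-cong (λ i → x≡ty+z i j) p)
          (trans (psumQ-linear t (λ i → y i j) (λ i → (1ℚ - t) * z i j) p)
            (cong (t * columnPsum y j p +_) (psumQ-scale (1ℚ - t) (λ i → z i j) p))))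

  vertices : ∀ x → IsVertex S x ⇔ Σ _ (λ M → S M × (∀ i j → x i j ≡ embed M i j))
  vertices x = mk⇔
    (λ { ((l , ok , total , x≡) , extreme) → extreme-in-S x extreme l ok total x≡ })
    (λ { (M , SM , x≡M) → point-in-hull M SM x≡M , point-extreme x M SM x≡M })

theorem9p7 : (lam : List ℕ) → IsPartition lam → (n : ℕ) → 1 ≤ n
    → (v : Vec ℕ (length lam)) → StrictlyIncreasing v → EntriesIn1toN n v
    → ∀ x → IsVertex (InMv v lam n) x ⇔ Σ _ (λ M → InMv v lam n M × (∀ i j → x i j ≡ embed M i j))
theorem9p7 lam _ n _ v _ _ = ZeroOneColumnHull.vertices (InMv v lam n) sign-matrix-columns
  where
  sign-matrix-columns : ZeroOneColumns (InMv v lam n)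
  sign-matrix-columns A (((_ , columns , _) , _) , _) = columns
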